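{- For any integer $n\ge 1$ and any nonzero octonions $a_1,\dots,a_n$ and any $z\in\mathbb{O}$, $$a_1(a_2(\cdots(a_nza_n^{ -1})\cdots)a_2^{ -1})a_1^{ -1}=a_1^{ -2}(a_2^{ -2}\cdots(a_n^{ -2}(b_nz)a_n^{ -1})\cdots a_2^{ -1})a_1^{ -1},$$ where $b_n=a_n^2(a_{n-1}^2\cdots(a_2^2a_1^3a_2)\cdots a_{n-1})a_n$ (and $b_1=a_1^3$).
   Context: $\mathbb{O}$ denotes the (real, 8-dimensional, alternative, non-associative) normed division algebra of octonions; for $a\neq0$, $a^{ -1}=\bar a/|a|^2$. Powers of a single octonion are unambiguous since any subalgebra generated by two elements is associative. -}

module Defs where

open import Level using (Level; suc; _⊔_)
open import Algebra.Bundles using (CommutativeRing)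
open import Data.Product using (_×_; _,_)
open import Data.List using (List; []; _∷_; map; foldr)
open import Data.List.Relation.Unary.All using (All)
import Data.Nat
open import Data.Vec using (Vec; []; _∷_)
open import Relation.Nullary using (¬_)

-- A field in which a finite sum of squares vanishes only if every term
-- vanishes (a formally real field).  The real numbers are such a field;
-- agda-stdlib has no real numbers, so the statement is made for every
-- such field.  The inverse is total, with the usual law for nonzero x.
record RealField (c ℓ : Level) : Set (suc (c ⊔ ℓ)) where
  field
    commutativeRing : CommutativeRing c ℓ
  open CommutativeRing commutativeRing public
  field
    _⁻¹         : Carrier → Carrier
    ⁻¹-inverse  : ∀ x → ¬ (x ≈ 0#) → x * (x ⁻¹) ≈ 1#
    0≉1         : ¬ (0# ≈ 1#)
    formallyReal : (xs : List Carrier) →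
                   foldr _+_ 0# (map (λ x → x * x) xs) ≈ 0# → All (_≈ 0#) xs

module Octonions {c ℓ : Level} (F : RealField c ℓ) where
  open RealField F

  -- Cayley–Dickson doubling: (a,b)(c,d) = (ac − d̄b , da + bc̄),
  -- conj (a,b) = (ā , −b).  ℂ = F², ℍ = ℂ², 𝕆 = ℍ².
  ℂ : Set c
  ℂ = Carrier × Carrier

  ℍ : Set c
  ℍ = ℂ × ℂ

  𝕆 : Set c
  𝕆 = ℍ × ℍ

  infixl 6 _+ᶜ_ _+ʰ_
  infixl 7 _*ᶜ_ _*ʰ_
  infix 8 -ᶜ_ -ʰ_

  _+ᶜ_ : ℂ → ℂ → ℂ
  (a , b) +ᶜ (c , d) = (a + c , b + d)
  -ᶜ_ : ℂ → ℂ
  -ᶜ (a , b) = (- a , - b)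
  conjᶜ : ℂ → ℂ
  conjᶜ (a , b) = (a , - b)
  _*ᶜ_ : ℂ → ℂ → ℂ
  (a , b) *ᶜ (c , d) = (a * c + - (d * b) , d * a + b * c)

  _+ʰ_ : ℍ → ℍ → ℍ
  (a , b) +ʰ (c , d) = (a +ᶜ c , b +ᶜ d)
  -ʰ_ : ℍ → ℍ
  -ʰ (a , b) = (-ᶜ a , -ᶜ b)
  conjʰ : ℍ → ℍ
  conjʰ (a , b) = (conjᶜ a , -ᶜ b)
  _*ʰ_ : ℍ → ℍ → ℍ
  (a , b) *ʰ (c , d) = (a *ᶜ c +ᶜ -ᶜ (conjᶜ d *ᶜ b) , d *ᶜ a +ᶜ b *ᶜ conjᶜ c)

  conjᵒ : 𝕆 → 𝕆
  conjᵒ (a , b) = (conjʰ a , -ʰ b)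
  _*ᵒ_ : 𝕆 → 𝕆 → 𝕆
  (a , b) *ᵒ (c , d) = (a *ʰ c +ʰ -ʰ (conjʰ d *ʰ b) , d *ʰ a +ʰ b *ʰ conjʰ c)

  infixl 7 _*ᵒ_

  coords : 𝕆 → List Carrier
  coords (((x0 , x1) , (x2 , x3)) , ((x4 , x5) , (x6 , x7))) =
    x0 ∷ x1 ∷ x2 ∷ x3 ∷ x4 ∷ x5 ∷ x6 ∷ x7 ∷ []

  scale : Carrier → 𝕆 → 𝕆
  scale r (((x0 , x1) , (x2 , x3)) , ((x4 , x5) , (x6 , x7))) =
    (((r * x0 , r * x1) , (r * x2 , r * x3)) , ((r * x4 , r * x5) , (r * x6 , r * x7)))

  normSq : 𝕆 → Carrier
  normSq a = foldr _+_ 0# (map (λ x → x * x) (coords a))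

  invᵒ : 𝕆 → 𝕆
  invᵒ a = scale (normSq a ⁻¹) (conjᵒ a)

  _≈ᵒ_ : 𝕆 → 𝕆 → Set ℓ
  (((x0 , x1) , (x2 , x3)) , ((x4 , x5) , (x6 , x7))) ≈ᵒ
    (((y0 , y1) , (y2 , y3)) , ((y4 , y5) , (y6 , y7))) =
    (x0 ≈ y0) × (x1 ≈ y1) × (x2 ≈ y2) × (x3 ≈ y3) ×
    (x4 ≈ y4) × (x5 ≈ y5) × (x6 ≈ y6) × (x7 ≈ y7)

  0ᵒ : 𝕆
  0ᵒ = (((0# , 0#) , (0# , 0#)) , ((0# , 0#) , (0# , 0#)))

  NonZeroᵒ : 𝕆 → Set ℓ
  NonZeroᵒ a = ¬ (a ≈ᵒ 0ᵒ)

  sq : 𝕆 → 𝕆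
  sq a = a *ᵒ a

  cube : 𝕆 → 𝕆
  cube a = (a *ᵒ a) *ᵒ a

  invSq : 𝕆 → 𝕆
  invSq a = sq (invᵒ a)

  lhs : ∀ {n} → Vec 𝕆 n → 𝕆 → 𝕆
  lhs []       z = z
  lhs (a ∷ as) z = (a *ᵒ lhs as z) *ᵒ invᵒ a

  -- bₙ = aₙ²(aₙ₋₁²⋯(a₂² a₁³ a₂)⋯aₙ₋₁)aₙ,  b₁ = a₁³
  bAux : ∀ {n} → 𝕆 → Vec 𝕆 n → 𝕆
  bAux acc []       = acc
  bAux acc (a ∷ as) = bAux ((sq a *ᵒ acc) *ᵒ a) as

  b : ∀ {n} → Vec 𝕆 (Data.Nat.suc n) → 𝕆
  b (a₁ ∷ as) = bAux (cube a₁) as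

  rhsCore : ∀ {n} → Vec 𝕆 n → 𝕆 → 𝕆
  rhsCore []       w = w
  rhsCore (a ∷ as) w = (invSq a *ᵒ rhsCore as w) *ᵒ invᵒ a

  rhs : ∀ {n} → Vec 𝕆 (Data.Nat.suc n) → 𝕆 → 𝕆
  rhs as z = rhsCore as (b as *ᵒ z)

module Submission where

-- The argument uses five octonion identities, each a polynomial identity in
-- the coordinates: left alternativity x²y = x(xy), the norm identity
-- x̄(xy) = |x|²y, compatibility of real scalars with products, and the left
-- and middle Moufang identities.  They are checked by normalising integer
-- polynomials with the sparse Horner normaliser of the ring solver and
-- transporting along the canonical morphism ℤ → R, valid in every
-- commutative ring; evaluating symbolic octonions also shows that the
-- product respects equality.  In a formally real field they give
-- a⁻¹(ay) = y for a ≠ 0.  The key step: if u(dy) = y for all y, then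
-- p((dy)u) = (u²(((d²p)d)y))u.  Iterating it over the layers gives the
-- invariant p · lhs(cs, z) = rhsCore(cs, bAux(p, cs) · z), and the theorem
-- is its case p = a₁³ after the cancellation a₁⁻²(a₁³ w) = a₁ w.

open import Level using (Level; 0ℓ; _⊔_)
open import Algebra.Bundles using (CommutativeRing)
open import Data.Bool using (Bool; true; false; T)
open import Data.Maybe using (nothing)
open import Data.Nat as ℕ using (ℕ; zero; suc)
import Data.Nat.Properties as ℕP
open import Data.Integer as ℤ using (ℤ; +_; -[1+_]; _⊖_)
import Data.Integer.Properties as ℤP
open import Data.Sign as Sign using (Sign)
open import Data.Fin using (#_)
open import Data.Product using (_×_; _,_)
open import Data.List.Relation.Unary.All as ListAll using ([]; _∷_)
open import Data.Vec using (Vec; []; _∷_; map; foldr; _++_)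
open import Data.Vec.Properties using (∷-injectiveˡ; ∷-injectiveʳ)
open import Data.Vec.Relation.Unary.All using (All; []; _∷_)
open import Data.Vec.Relation.Binary.Pointwise.Inductive as PW using (Pointwise; []; _∷_)
open import Relation.Binary.Bundles using (Setoid)
open import Relation.Binary.PropositionalEquality as P using (_≡_)
open import Relation.Nullary using (¬_)
open import Tactic.RingSolver.Core.AlmostCommutativeRing using (AlmostCommutativeRing; fromCommutativeRing)
open import Tactic.RingSolver.Core.Polynomial.Parameters using (RawCoeff; Homomorphism)
open import Tactic.RingSolver.Core.Expression using (Expr; Κ; Ι; _⊕_; _⊗_; ⊝_; _⊛_; module Eval)
open import Defs

ℤ-coefficients : RawCoeff 0ℓ 0ℓ
ℤ-coefficients = record
  { rawRing = CommutativeRing.rawRing ℤP.+-*-commutativeRing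
  ; isZero  = isZero
  }
  where
  isZero : ℤ → Bool
  isZero (+ zero) = true
  isZero _        = false

open import Tactic.RingSolver.Core.Polynomial.Base ℤ-coefficients
  using (Poly; κ; ι; _⊞_; _⊠_; ⊟_; _⊡_)

normalise : ∀ {n} → Expr ℤ n → Poly n
normalise (Κ x)   = κ x
normalise (Ι x)   = ι x
normalise (x ⊕ y) = normalise x ⊞ normalise y
normalise (x ⊗ y) = normalise x ⊠ normalise y
normalise (⊝ x)   = ⊟ normalise x
normalise (x ⊛ i) = normalise x ⊡ i

-- Every commutative ring receives the canonical ring morphism from ℤ, so
-- two integer polynomial expressions with the same normal form evaluate to
-- equal elements of it under every assignment of the variables.
module PolynomialIdentities {c ℓ : Level} (R : CommutativeRing c ℓ) where
  open CommutativeRing R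
  open import Algebra.Properties.Ring ring using (-‿distribˡ-*; -‿distribʳ-*; -‿involutive; -0#≈0#; -‿+-comm)
  open import Algebra.Properties.Semiring.Mult semiring using (×-homo-+; ×1-homo-*) renaming (_×_ to _×ᴿ_)
  open import Relation.Binary.Reasoning.Setoid setoid

  nat : ℕ → Carrier
  nat n = n ×ᴿ 1#

  int : ℤ → Carrier
  int (+ n)    = nat n
  int -[1+ n ] = - nat (suc n)

  cancel-1 : ∀ a b → (1# + a) + - (1# + b) ≈ a + - b
  cancel-1 a b = begin
    (1# + a) + - (1# + b)    ≈⟨ +-congˡ (-‿+-comm 1# b) ⟨
    (1# + a) + (- 1# + - b)  ≈⟨ +-congʳ (+-comm 1# a) ⟩
    (a + 1#) + (- 1# + - b)  ≈⟨ +-assoc a 1# _ ⟩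
    a + (1# + (- 1# + - b))  ≈⟨ +-congˡ (+-assoc 1# (- 1#) (- b)) ⟨
    a + ((1# + - 1#) + - b)  ≈⟨ +-congˡ (+-congʳ (-‿inverseʳ 1#)) ⟩
    a + (0# + - b)           ≈⟨ +-congˡ (+-identityˡ (- b)) ⟩
    a + - b                  ∎

  int-⊖ : ∀ m n → int (m ⊖ n) ≈ nat m + - nat n
  int-⊖ m       zero    = sym (trans (+-congˡ -0#≈0#) (+-identityʳ (nat m)))
  int-⊖ zero    (suc n) = sym (+-identityˡ _)
  int-⊖ (suc m) (suc n) rewrite ℤP.[1+m]⊖[1+n]≡m⊖n m n =
    trans (int-⊖ m n) (sym (cancel-1 (nat m) (nat n)))

  int-+ : ∀ i j → int (i ℤ.+ j) ≈ int i + int j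
  int-+ (+ m)    (+ n)    = ×-homo-+ 1# m n
  int-+ (+ m)    -[1+ n ] = int-⊖ m (suc n)
  int-+ -[1+ m ] (+ n)    = trans (int-⊖ n (suc m)) (+-comm _ _)
  int-+ -[1+ m ] -[1+ n ] = begin
    - nat (suc (suc (m ℕ.+ n)))    ≡⟨ P.cong (λ k → - nat k) (ℕP.+-suc (suc m) n) ⟨
    - nat (suc m ℕ.+ suc n)        ≈⟨ -‿cong (×-homo-+ 1# (suc m) (suc n)) ⟩
    - (nat (suc m) + nat (suc n))  ≈⟨ -‿+-comm _ _ ⟨
    - nat (suc m) + - nat (suc n)  ∎

  int-neg : ∀ i → int (ℤ.- i) ≈ - int i
  int-neg (+ zero)   = sym -0#≈0#
  int-neg (+ suc n)  = refl
  int-neg -[1+ n ]   = sym (-‿involutive _)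

  -- Integer multiplication is defined through the signed naturals s ◃ n,
  -- so multiplicativity of int goes through their values.
  signed : Sign → Carrier → Carrier
  signed Sign.+ x = x
  signed Sign.- x = - x

  int-◃ : ∀ s n → int (s ℤ.◃ n) ≈ signed s (nat n)
  int-◃ Sign.+ zero    = refl
  int-◃ Sign.- zero    = sym -0#≈0#
  int-◃ Sign.+ (suc n) = refl
  int-◃ Sign.- (suc n) = refl

  -x*-y≈x*y : ∀ x y → - x * - y ≈ x * y
  -x*-y≈x*y x y = begin
    - x * - y      ≈⟨ -‿distribˡ-* x (- y) ⟨
    - (x * - y)    ≈⟨ -‿cong (-‿distribʳ-* x y) ⟨
    - - (x * y)    ≈⟨ -‿involutive (x * y) ⟩
    x * y          ∎

  int-* : ∀ i j → int (i ℤ.* j) ≈ int i * int j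
  int-* (+ m)    (+ n)    = trans (int-◃ Sign.+ (m ℕ.* n)) (×1-homo-* m n)
  int-* (+ m)    -[1+ n ] = trans (int-◃ Sign.- (m ℕ.* suc n))
    (trans (-‿cong (×1-homo-* m (suc n))) (-‿distribʳ-* _ _))
  int-* -[1+ m ] (+ n)    = trans (int-◃ Sign.- (suc m ℕ.* n))
    (trans (-‿cong (×1-homo-* (suc m) n)) (-‿distribˡ-* _ _))
  int-* -[1+ m ] -[1+ n ] = trans (int-◃ Sign.+ (suc m ℕ.* suc n))
    (trans (×1-homo-* (suc m) (suc n)) (sym (-x*-y≈x*y _ _)))

  -- R as the target of the normaliser; no zero test is needed.
  ring-of-R : AlmostCommutativeRing c ℓ
  ring-of-R = fromCommutativeRing R (λ _ → nothing)

  ℤ-morphism : Homomorphism 0ℓ 0ℓ c ℓ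
  ℤ-morphism = record
    { from          = ℤ-coefficients
    ; to            = ring-of-R
    ; morphism      = record
      { ⟦_⟧    = int
      ; +-homo = int-+
      ; *-homo = int-*
      ; -‿homo = int-neg
      ; 0-homo = refl
      ; 1-homo = +-identityʳ 1#
      }
    ; Zero-C⟶Zero-R = int-0
    }
    where
    int-0 : ∀ x → T (RawCoeff.isZero ℤ-coefficients x) → 0# ≈ int x
    int-0 (+ zero) _ = refl

  open Eval (AlmostCommutativeRing.rawRing ring-of-R) int public using (⟦_⟧)
  open import Tactic.RingSolver.Core.Polynomial.Semantics ℤ-morphism using () renaming (⟦_⟧ to ⟦_⟧ₚ)
  open import Tactic.RingSolver.Core.Polynomial.Homomorphism ℤ-morphism using (κ-hom; ι-hom; ⊞-hom; ⊠-hom; ⊟-hom; ⊡-hom)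
  open import Algebra.Properties.Semiring.Exp.TCOptimised (AlmostCommutativeRing.semiring ring-of-R) using (^-congˡ)

  normalise-correct : ∀ {n} (e : Expr ℤ n) ρ → ⟦ normalise e ⟧ₚ ρ ≈ ⟦ e ⟧ ρ
  normalise-correct (Κ x)   ρ = κ-hom x ρ
  normalise-correct (Ι x)   ρ = ι-hom x ρ
  normalise-correct (x ⊕ y) ρ = trans (⊞-hom (normalise x) (normalise y) ρ) (+-cong (normalise-correct x ρ) (normalise-correct y ρ))
  normalise-correct (x ⊗ y) ρ = trans (⊠-hom (normalise x) (normalise y) ρ) (*-cong (normalise-correct x ρ) (normalise-correct y ρ))
  normalise-correct (⊝ x)   ρ = trans (⊟-hom (normalise x) ρ) (-‿cong (normalise-correct x ρ))
  normalise-correct (x ⊛ i) ρ = trans (⊡-hom (normalise x) i ρ) (^-congˡ i (normalise-correct x ρ))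

  by-normalisation : ∀ {n} (e₁ e₂ : Expr ℤ n) → normalise e₁ ≡ normalise e₂ →
                     ∀ ρ → ⟦ e₁ ⟧ ρ ≈ ⟦ e₂ ⟧ ρ
  by-normalisation e₁ e₂ same ρ = begin
    ⟦ e₁ ⟧ ρ                ≈⟨ normalise-correct e₁ ρ ⟨
    ⟦ normalise e₁ ⟧ₚ ρ     ≡⟨ P.cong (λ p → ⟦ p ⟧ₚ ρ) same ⟩
    ⟦ normalise e₂ ⟧ₚ ρ     ≈⟨ normalise-correct e₂ ρ ⟩
    ⟦ e₂ ⟧ ρ                ∎

-- Symbolic octonions: octonions whose coordinates are integer polynomial
-- expressions in n variables, with the Cayley–Dickson formulas of Defs
-- transcribed verbatim.
module Symbolic {n : ℕ} where
  Term : Set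
  Term = Expr ℤ n

  Termᶜ Termʰ Termᵒ : Set
  Termᶜ = Term × Term
  Termʰ = Termᶜ × Termᶜ
  Termᵒ = Termʰ × Termʰ

  infixl 6 _+ᶜ_ _+ʰ_
  infixl 7 _*ᶜ_ _*ʰ_ _*ˢ_
  infix 8 -ᶜ_ -ʰ_

  _+ᶜ_ : Termᶜ → Termᶜ → Termᶜ
  (a , b) +ᶜ (c , d) = (a ⊕ c , b ⊕ d)
  -ᶜ_ : Termᶜ → Termᶜ
  -ᶜ (a , b) = (⊝ a , ⊝ b)
  conjᶜ : Termᶜ → Termᶜ
  conjᶜ (a , b) = (a , ⊝ b)
  _*ᶜ_ : Termᶜ → Termᶜ → Termᶜ
  (a , b) *ᶜ (c , d) = (a ⊗ c ⊕ ⊝ (d ⊗ b) , d ⊗ a ⊕ b ⊗ c)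

  _+ʰ_ : Termʰ → Termʰ → Termʰ
  (a , b) +ʰ (c , d) = (a +ᶜ c , b +ᶜ d)
  -ʰ_ : Termʰ → Termʰ
  -ʰ (a , b) = (-ᶜ a , -ᶜ b)
  conjʰ : Termʰ → Termʰ
  conjʰ (a , b) = (conjᶜ a , -ᶜ b)
  _*ʰ_ : Termʰ → Termʰ → Termʰ
  (a , b) *ʰ (c , d) = (a *ᶜ c +ᶜ -ᶜ (conjᶜ d *ᶜ b) , d *ᶜ a +ᶜ b *ᶜ conjᶜ c)

  conjˢ : Termᵒ → Termᵒ
  conjˢ (a , b) = (conjʰ a , -ʰ b)
  _*ˢ_ : Termᵒ → Termᵒ → Termᵒ
  (a , b) *ˢ (c , d) = (a *ʰ c +ʰ -ʰ (conjʰ d *ʰ b) , d *ʰ a +ʰ b *ʰ conjʰ c)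

  scaleˢ : Term → Termᵒ → Termᵒ
  scaleˢ r (((x0 , x1) , (x2 , x3)) , ((x4 , x5) , (x6 , x7))) =
    (((r ⊗ x0 , r ⊗ x1) , (r ⊗ x2 , r ⊗ x3)) , ((r ⊗ x4 , r ⊗ x5) , (r ⊗ x6 , r ⊗ x7)))

  coordinates : Termᵒ → Vec Term 8
  coordinates (((x0 , x1) , (x2 , x3)) , ((x4 , x5) , (x6 , x7))) =
    x0 ∷ x1 ∷ x2 ∷ x3 ∷ x4 ∷ x5 ∷ x6 ∷ x7 ∷ []

  normSqˢ : Termᵒ → Term
  normSqˢ a = foldr _ _⊕_ (Κ (+ 0)) (map (λ x → x ⊗ x) (coordinates a))

open Symbolic using (Termᵒ; _*ˢ_; conjˢ; scaleˢ; normSqˢ)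

-- The octonion variables: Xₖ has coordinates the variables 8k, …, 8k+7, in
-- any context with at least 8(k+1) variables.
X₀ : ∀ {n} → Termᵒ {8 ℕ.+ n}
X₀ = (((Ι (# 0) , Ι (# 1)) , (Ι (# 2) , Ι (# 3))) , ((Ι (# 4) , Ι (# 5)) , (Ι (# 6) , Ι (# 7))))

X₁ : ∀ {n} → Termᵒ {16 ℕ.+ n}
X₁ = (((Ι (# 8) , Ι (# 9)) , (Ι (# 10) , Ι (# 11))) , ((Ι (# 12) , Ι (# 13)) , (Ι (# 14) , Ι (# 15))))

X₂ : ∀ {n} → Termᵒ {24 ℕ.+ n}
X₂ = (((Ι (# 16) , Ι (# 17)) , (Ι (# 18) , Ι (# 19))) , ((Ι (# 20) , Ι (# 21)) , (Ι (# 22) , Ι (# 23))))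

Same-normal-form : ∀ {n} → Termᵒ {n} → Termᵒ {n} → Set
Same-normal-form A B =
  map normalise (Symbolic.coordinates A) ≡ map normalise (Symbolic.coordinates B)

module OctonionAlgebra {c ℓ : Level} (F : RealField c ℓ) where
  open RealField F
  open Octonions F
  open PolynomialIdentities commutativeRing
  open import Algebra.Properties.Semiring.Exp.TCOptimised semiring using (^-congˡ)

  -- Equality of octonions.  It is _≈ᵒ_ behind a record type, so that type
  -- checking compares octonion expressions instead of unfolding them into
  -- their eight (very large) coordinates.
  infix 4 _≋_
  record _≋_ (x y : 𝕆) : Set ℓ where
    constructor wrap
    field unwrap : x ≈ᵒ y
  open _≋_ public

  coordinates : 𝕆 → Vec Carrier 8
  coordinates (((x0 , x1) , (x2 , x3)) , ((x4 , x5) , (x6 , x7))) =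
    x0 ∷ x1 ∷ x2 ∷ x3 ∷ x4 ∷ x5 ∷ x6 ∷ x7 ∷ []

  ≋⇒pointwise : ∀ {x y} → x ≋ y → Pointwise _≈_ (coordinates x) (coordinates y)
  ≋⇒pointwise (wrap (p0 , p1 , p2 , p3 , p4 , p5 , p6 , p7)) =
    p0 ∷ p1 ∷ p2 ∷ p3 ∷ p4 ∷ p5 ∷ p6 ∷ p7 ∷ []

  pointwise⇒≋ : ∀ {x y} → Pointwise _≈_ (coordinates x) (coordinates y) → x ≋ y
  pointwise⇒≋ (p0 ∷ p1 ∷ p2 ∷ p3 ∷ p4 ∷ p5 ∷ p6 ∷ p7 ∷ []) =
    wrap (p0 , p1 , p2 , p3 , p4 , p5 , p6 , p7)

  ≋-setoid : Setoid c ℓ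
  ≋-setoid = record
    { Carrier       = 𝕆
    ; _≈_           = _≋_
    ; isEquivalence = record
      { refl  = pointwise⇒≋ (PW.refl refl)
      ; sym   = λ p → pointwise⇒≋ (PW.sym sym (≋⇒pointwise p))
      ; trans = λ p q → pointwise⇒≋ (PW.trans trans (≋⇒pointwise p) (≋⇒pointwise q))
      }
    }

  open Setoid ≋-setoid using () renaming (refl to ≋-refl)
  open import Relation.Binary.Reasoning.Setoid ≋-setoid

  evalᵒ : ∀ {n} → Termᵒ {n} → Vec Carrier n → 𝕆
  evalᵒ (((x0 , x1) , (x2 , x3)) , ((x4 , x5) , (x6 , x7))) ρ =
    (((⟦ x0 ⟧ ρ , ⟦ x1 ⟧ ρ) , (⟦ x2 ⟧ ρ , ⟦ x3 ⟧ ρ)) , ((⟦ x4 ⟧ ρ , ⟦ x5 ⟧ ρ) , (⟦ x6 ⟧ ρ , ⟦ x7 ⟧ ρ)))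

  ⟦⟧-cong : ∀ {n} (e : Expr ℤ n) {ρ ρ′} → Pointwise _≈_ ρ ρ′ → ⟦ e ⟧ ρ ≈ ⟦ e ⟧ ρ′
  ⟦⟧-cong (Κ x)   ρ≈ρ′ = refl
  ⟦⟧-cong (Ι i)   ρ≈ρ′ = PW.lookup ρ≈ρ′ i
  ⟦⟧-cong (x ⊕ y) ρ≈ρ′ = +-cong (⟦⟧-cong x ρ≈ρ′) (⟦⟧-cong y ρ≈ρ′)
  ⟦⟧-cong (x ⊗ y) ρ≈ρ′ = *-cong (⟦⟧-cong x ρ≈ρ′) (⟦⟧-cong y ρ≈ρ′)
  ⟦⟧-cong (⊝ x)   ρ≈ρ′ = -‿cong (⟦⟧-cong x ρ≈ρ′)
  ⟦⟧-cong (x ⊛ i) ρ≈ρ′ = ^-congˡ i (⟦⟧-cong x ρ≈ρ′)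

  -- Hence every operation built from octonion formulas is a congruence.
  evalᵒ-cong : ∀ {n} (A : Termᵒ {n}) {ρ ρ′ : Vec Carrier n} →
               Pointwise _≈_ ρ ρ′ → evalᵒ A ρ ≋ evalᵒ A ρ′
  evalᵒ-cong {n} A {ρ} {ρ′} ρ≈ρ′ = pointwise⇒≋ (all-cong (Symbolic.coordinates A))
    where
    all-cong : ∀ {k} (es : Vec (Expr ℤ n) k) →
               Pointwise _≈_ (map (λ e → ⟦ e ⟧ ρ) es) (map (λ e → ⟦ e ⟧ ρ′) es)
    all-cong []       = []
    all-cong (e ∷ es) = ⟦⟧-cong e ρ≈ρ′ ∷ all-cong es

  octonion-identity : ∀ {n} (A B : Termᵒ {n}) → Same-normal-form A B →
                      ∀ ρ → evalᵒ A ρ ≋ evalᵒ B ρ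
  octonion-identity {n} A B same ρ =
    pointwise⇒≋ (each (Symbolic.coordinates A) (Symbolic.coordinates B) same)
    where
    each : ∀ {k} (as bs : Vec (Expr ℤ n) k) → map normalise as ≡ map normalise bs →
           Pointwise _≈_ (map (λ e → ⟦ e ⟧ ρ) as) (map (λ e → ⟦ e ⟧ ρ) bs)
    each []       []       _    = []
    each (a ∷ as) (b ∷ bs) same =
      by-normalisation a b (∷-injectiveˡ same) ρ ∷ each as bs (∷-injectiveʳ same)

  *ᵒ-cong : ∀ {x x′ y y′} → x ≋ x′ → y ≋ y′ → (x *ᵒ y) ≋ (x′ *ᵒ y′)
  *ᵒ-cong x≋x′ y≋y′ = evalᵒ-cong {16} (X₀ *ˢ X₁) (PW.++⁺ (≋⇒pointwise x≋x′) (≋⇒pointwise y≋y′))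

  *ᵒ-congˡ : ∀ {x y y′} → y ≋ y′ → (x *ᵒ y) ≋ (x *ᵒ y′)
  *ᵒ-congˡ = *ᵒ-cong ≋-refl

  *ᵒ-congʳ : ∀ {x x′ y} → x ≋ x′ → (x *ᵒ y) ≋ (x′ *ᵒ y)
  *ᵒ-congʳ x≋x′ = *ᵒ-cong x≋x′ ≋-refl

  scale-congʳ : ∀ {k y y′} → y ≋ y′ → scale k y ≋ scale k y′
  scale-congʳ (wrap (p0 , p1 , p2 , p3 , p4 , p5 , p6 , p7)) = wrap
    (*-congˡ p0 , *-congˡ p1 , *-congˡ p2 , *-congˡ p3 , *-congˡ p4 , *-congˡ p5 , *-congˡ p6 , *-congˡ p7)

  left-alternative : ∀ x y → (sq x *ᵒ y) ≋ (x *ᵒ (x *ᵒ y))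
  left-alternative x y = octonion-identity {16} ((X₀ *ˢ X₀) *ˢ X₁) (X₀ *ˢ (X₀ *ˢ X₁)) P.refl
    (coordinates x ++ coordinates y)

  norm-identity : ∀ x y → (conjᵒ x *ᵒ (x *ᵒ y)) ≋ scale (normSq x) y
  norm-identity x y = octonion-identity {16} (conjˢ X₀ *ˢ (X₀ *ˢ X₁)) (scaleˢ (normSqˢ X₀) X₁) P.refl
    (coordinates x ++ coordinates y)

  scale-*ᵒ : ∀ k x y → (scale k x *ᵒ y) ≋ scale k (x *ᵒ y)
  scale-*ᵒ k x y = octonion-identity {17} (scaleˢ K X₀ *ˢ X₁) (scaleˢ K (X₀ *ˢ X₁)) P.refl
    (coordinates x ++ coordinates y ++ k ∷ [])
    where K = Ι (# 16)

  left-Moufang : ∀ x y z → (((x *ᵒ y) *ᵒ x) *ᵒ z) ≋ (x *ᵒ (y *ᵒ (x *ᵒ z)))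
  left-Moufang x y z = octonion-identity {24} (((X₀ *ˢ X₁) *ˢ X₀) *ˢ X₂) (X₀ *ˢ (X₁ *ˢ (X₀ *ˢ X₂))) P.refl
    (coordinates x ++ coordinates y ++ coordinates z)

  middle-Moufang : ∀ x y z → ((x *ᵒ (y *ᵒ z)) *ᵒ x) ≋ ((x *ᵒ y) *ᵒ (z *ᵒ x))
  middle-Moufang x y z = octonion-identity {24} ((X₀ *ˢ (X₁ *ˢ X₂)) *ˢ X₀) ((X₀ *ˢ X₁) *ˢ (X₂ *ˢ X₀)) P.refl
    (coordinates x ++ coordinates y ++ coordinates z)

  scale-inverse : ∀ {k m} y → k * m ≈ 1# → scale k (scale m y) ≋ y
  scale-inverse {k} {m} y km≈1 = wrap (cancel , cancel , cancel , cancel , cancel , cancel , cancel , cancel)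
    where
    cancel : ∀ {x} → k * (m * x) ≈ x
    cancel {x} = trans (sym (*-assoc k m x)) (trans (*-congʳ km≈1) (*-identityˡ x))

  normSq-nonzero : ∀ {a} → NonZeroᵒ a → ¬ (normSq a ≈ 0#)
  normSq-nonzero {a} a≉0 |a|²≈0 = a≉0 (all-zero (formallyReal (coords a) |a|²≈0))
    where
    all-zero : ListAll.All (_≈ 0#) (coords a) → a ≈ᵒ 0ᵒ
    all-zero (p0 ∷ p1 ∷ p2 ∷ p3 ∷ p4 ∷ p5 ∷ p6 ∷ p7 ∷ []) = p0 , p1 , p2 , p3 , p4 , p5 , p6 , p7

  -- a⁻¹(a y) = y for a ≠ 0: ā(a y) = |a|² y by the norm identity.
  inverse-cancelˡ : ∀ a → NonZeroᵒ a → ∀ y → (invᵒ a *ᵒ (a *ᵒ y)) ≋ y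
  inverse-cancelˡ a a≉0 y = begin
    scale k (conjᵒ a) *ᵒ (a *ᵒ y)  ≈⟨ scale-*ᵒ k (conjᵒ a) (a *ᵒ y) ⟩
    scale k (conjᵒ a *ᵒ (a *ᵒ y))  ≈⟨ scale-congʳ (norm-identity a y) ⟩
    scale k (scale (normSq a) y)   ≈⟨ scale-inverse y k|a|²≈1 ⟩
    y                              ∎
    where
    k = normSq a ⁻¹
    k|a|²≈1 : k * normSq a ≈ 1#
    k|a|²≈1 = trans (*-comm k (normSq a)) (⁻¹-inverse (normSq a) (normSq-nonzero a≉0))

  -- a⁻²(a(a w)) = w for a ≠ 0, since a⁻² y = a⁻¹(a⁻¹ y) by left alternativity.
  inverse-square-cancelˡ : ∀ a → NonZeroᵒ a → ∀ w → (sq (invᵒ a) *ᵒ (a *ᵒ (a *ᵒ w))) ≋ w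
  inverse-square-cancelˡ a a≉0 w = begin
    sq (invᵒ a) *ᵒ (a *ᵒ (a *ᵒ w))          ≈⟨ left-alternative (invᵒ a) (a *ᵒ (a *ᵒ w)) ⟩
    invᵒ a *ᵒ (invᵒ a *ᵒ (a *ᵒ (a *ᵒ w)))   ≈⟨ *ᵒ-congˡ (inverse-cancelˡ a a≉0 (a *ᵒ w)) ⟩
    invᵒ a *ᵒ (a *ᵒ w)                      ≈⟨ inverse-cancelˡ a a≉0 w ⟩
    w                                       ∎

  conjugation-step : ∀ d u → (∀ y → (u *ᵒ (d *ᵒ y)) ≋ y) → ∀ p y →
    (p *ᵒ ((d *ᵒ y) *ᵒ u)) ≋ ((sq u *ᵒ (((sq d *ᵒ p) *ᵒ d) *ᵒ y)) *ᵒ u)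
  conjugation-step d u u-cancels p y = begin
    p *ᵒ ((d *ᵒ y) *ᵒ u)
      ≈⟨ *ᵒ-congʳ (u-cancels p) ⟨
    (u *ᵒ (d *ᵒ p)) *ᵒ ((d *ᵒ y) *ᵒ u)
      ≈⟨ middle-Moufang u (d *ᵒ p) (d *ᵒ y) ⟨
    (u *ᵒ ((d *ᵒ p) *ᵒ (d *ᵒ y))) *ᵒ u
      ≈⟨ *ᵒ-congʳ (*ᵒ-congˡ (u-cancels ((d *ᵒ p) *ᵒ (d *ᵒ y)))) ⟨
    (u *ᵒ (u *ᵒ (d *ᵒ ((d *ᵒ p) *ᵒ (d *ᵒ y))))) *ᵒ u
      ≈⟨ *ᵒ-congʳ (left-alternative u (d *ᵒ ((d *ᵒ p) *ᵒ (d *ᵒ y)))) ⟨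
    (sq u *ᵒ (d *ᵒ ((d *ᵒ p) *ᵒ (d *ᵒ y)))) *ᵒ u
      ≈⟨ *ᵒ-congʳ (*ᵒ-congˡ (left-Moufang d (d *ᵒ p) y)) ⟨
    (sq u *ᵒ (((d *ᵒ (d *ᵒ p)) *ᵒ d) *ᵒ y)) *ᵒ u
      ≈⟨ *ᵒ-congʳ (*ᵒ-congˡ (*ᵒ-congʳ (*ᵒ-congʳ (left-alternative d p)))) ⟨
    (sq u *ᵒ (((sq d *ᵒ p) *ᵒ d) *ᵒ y)) *ᵒ u ∎

  rhsCore-∷ : ∀ {m} d (cs : Vec 𝕆 m) w → ((sq (invᵒ d) *ᵒ rhsCore cs w) *ᵒ invᵒ d) ≋ rhsCore (d ∷ cs) w
  rhsCore-∷ d cs w = ≋-refl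

  Absorbs : ∀ {m} → Vec 𝕆 m → Set (c ⊔ ℓ)
  Absorbs cs = ∀ p z → (p *ᵒ lhs cs z) ≋ rhsCore cs (bAux p cs *ᵒ z)

  absorbs-∷ : ∀ {m} d {cs : Vec 𝕆 m} → NonZeroᵒ d → Absorbs cs → Absorbs (d ∷ cs)
  absorbs-∷ d {cs} d≉0 absorbs-cs p z = begin
    p *ᵒ ((d *ᵒ lhs cs z) *ᵒ invᵒ d)
      ≈⟨ conjugation-step d (invᵒ d) (inverse-cancelˡ d d≉0) p (lhs cs z) ⟩
    (sq (invᵒ d) *ᵒ (((sq d *ᵒ p) *ᵒ d) *ᵒ lhs cs z)) *ᵒ invᵒ d
      ≈⟨ *ᵒ-congʳ (*ᵒ-congˡ (absorbs-cs ((sq d *ᵒ p) *ᵒ d) z)) ⟩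
    (sq (invᵒ d) *ᵒ rhsCore cs (bAux ((sq d *ᵒ p) *ᵒ d) cs *ᵒ z)) *ᵒ invᵒ d
      ≈⟨ rhsCore-∷ d cs (bAux p (d ∷ cs) *ᵒ z) ⟩
    rhsCore (d ∷ cs) (bAux p (d ∷ cs) *ᵒ z) ∎

  absorbs : ∀ {m} {cs : Vec 𝕆 m} → All NonZeroᵒ cs → Absorbs cs
  absorbs {cs = []}     []             p z = ≋-refl
  absorbs {cs = d ∷ cs} (d≉0 ∷ cs≉0)       = absorbs-∷ d d≉0 (absorbs cs≉0)

  -- The theorem up to ≋: absorb a₁³ into the inner layers, then cancel
  -- a₁⁻²(a₁³ w) = a₁ w in the outermost one.
  nested-conjugation : ∀ n (as : Vec 𝕆 (suc n)) → All NonZeroᵒ as → ∀ z → lhs as z ≋ rhs as z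
  nested-conjugation n (a ∷ as) (a≉0 ∷ as≉0) z = begin
    (a *ᵒ lhs as z) *ᵒ invᵒ a
      ≈⟨ *ᵒ-congʳ (inverse-square-cancelˡ a a≉0 (a *ᵒ lhs as z)) ⟨
    (sq (invᵒ a) *ᵒ (a *ᵒ (a *ᵒ (a *ᵒ lhs as z)))) *ᵒ invᵒ a
      ≈⟨ *ᵒ-congʳ (*ᵒ-congˡ (left-Moufang a a (lhs as z))) ⟨
    (sq (invᵒ a) *ᵒ (cube a *ᵒ lhs as z)) *ᵒ invᵒ a
      ≈⟨ *ᵒ-congʳ (*ᵒ-congˡ (absorbs as≉0 (cube a) z)) ⟩
    (sq (invᵒ a) *ᵒ rhsCore as (bAux (cube a) as *ᵒ z)) *ᵒ invᵒ a
      ≈⟨ rhsCore-∷ a as (bAux (cube a) as *ᵒ z) ⟩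
    rhsCore (a ∷ as) (bAux (cube a) as *ᵒ z) ∎

lemma4 : {c ℓ : Level} (F : RealField c ℓ) → let open Octonions F in
    (n : ℕ) (as : Vec 𝕆 (suc n)) → All NonZeroᵒ as → (z : 𝕆) →
    lhs as z ≈ᵒ rhs as z
lemma4 F n as as≉0 z = unwrap (nested-conjugation n as as≉0 z)
  where open OctonionAlgebra F
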